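{- Let $(p,p')$ be positive integers with $|p-p'|=1$, and let $X=\alpha_{(p,p')}(Y)$ be a Sturmian word. Let $x$ be a palindrome occurring in $X$ whose center occurrence $c$ satisfies $c\neq b$ (so $c\in\{a,aa\}$). Then $x$ is original in $X$ if and only if $c$ is not the center of the $a$-sequence of $X$ containing it.
   Context: Words are over the alphabet $\{a,b\}$. A Sturmian word is a right-infinite aperiodic word over $\{a,b\}$ of minimal factor complexity (the term is also applied to finite factors of such words). For positive integers $p,p'$ with $|p-p'|=1$, $\alpha=\alpha_{(p,p')}$ is the morphism $a\mapsto a^pb$, $b\mapsto a^{p'}b$. A palindrome is a word equal to its reverse; its center is its middle letter if its length is odd and its two middle letters (necessarily $aa$) if even. An $a$-sequence of a word $S$ is a factor $A$ in an occurrence $S=UAV$ with $|A|_b=0$, $U$ ending with $b$ and $V$ starting with $b$ (a maximal run of $a$'s between two $b$'s); the center of an $a$-sequence $a^m$ is its middle letter ($m$ odd) or middle two letters ($m$ even). Original/reflection: consider a palindrome occurrence in $X=\alpha(Y)$ with center occurrence $c\in\{a,b,aa\}$, $X=x_1cx_2$. It is a reflection if there is a factorization $Y=t_1\,l\,t_2$ with $l\in\{a,b,aa\}$ such that $\alpha(l)=ucv$, $x_1=\alpha(t_1)u$, $x_2=v\alpha(t_2)$ and this occurrence of $c$ is the center of the palindrome $b\alpha(l)=b\,u\,c\,v$ (i.e. $|bu|=|v|$); otherwise it is original. -}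

module Defs where

open import Data.Nat using (ℕ; zero; suc; _+_; _≤_; _<_)
open import Data.List using (List; []; _∷_; _++_; length; concatMap; replicate; reverse)
open import Data.List.Membership.Propositional using (_∈_)
open import Data.List.Relation.Unary.Unique.Propositional using (Unique)
open import Data.Product using (Σ; ∃; ∃-syntax; _×_; _,_)
open import Data.Sum using (_⊎_)
open import Relation.Nullary using (¬_)
open import Relation.Binary.PropositionalEquality using (_≡_)

data Letter : Set where
  a b : Letter

Word : Set
Word = List Letter

InfWord : Set
InfWord = ℕ → Letter

factorAt : InfWord → ℕ → ℕ → Word
factorAt w i zero    = []
factorAt w i (suc n) = w i ∷ factorAt w (suc i) n

EventuallyPeriodic : InfWord → Set
EventuallyPeriodic w = ∃[ k ] ∃[ N ] (0 < k × (∀ i → N ≤ i → w (i + k) ≡ w i))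

ComplexityNPlusOne : InfWord → Set
ComplexityNPlusOne w =
  ∀ n → Σ (List Word) λ L →
      Unique L
    × length L ≡ suc n
    × (∀ i → factorAt w i n ∈ L)
    × (∀ u → u ∈ L → ∃[ i ] factorAt w i n ≡ u)

SturmianInf : InfWord → Set
SturmianInf w = ¬ EventuallyPeriodic w × ComplexityNPlusOne w

Sturmian : Word → Set
Sturmian u = ∃[ w ] (SturmianInf w × ∃[ i ] factorAt w i (length u) ≡ u)

αl : ℕ → ℕ → Letter → Word
αl p p' a = replicate p a ++ b ∷ []
αl p p' b = replicate p' a ++ b ∷ []

α : ℕ → ℕ → Word → Word
α p p' = concatMap (αl p p')

DiffOne : ℕ → ℕ → Set
DiffOne p p' = suc p ≡ p' ⊎ suc p' ≡ p

Reflection : ℕ → ℕ → Word → Word → Word → Word → Set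
Reflection p p' Y x₁ c x₂ =
  ∃[ t₁ ] ∃[ l ] ∃[ t₂ ] ∃[ u ] ∃[ v ]
      Y ≡ t₁ ++ l ++ t₂
    × (l ≡ a ∷ [] ⊎ l ≡ b ∷ [] ⊎ l ≡ a ∷ a ∷ [])
    × α p p' l ≡ u ++ c ++ v
    × x₁ ≡ α p p' t₁ ++ u
    × x₂ ≡ v ++ α p p' t₂
    × suc (length u) ≡ length v

Original : ℕ → ℕ → Word → Word → Word → Word → Set
Original p p' Y x₁ c x₂ = ¬ Reflection p p' Y x₁ c x₂

ASequence : Word → Word → ℕ → Word → Set
ASequence X U m V =
  X ≡ U ++ replicate m a ++ V
  × (∃[ U' ] U ≡ U' ++ b ∷ [])
  × (∃[ V' ] V ≡ b ∷ V')

-- An image α(Y) is a concatenation of blocks a^k b, one per letter of Y, so the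
-- a-sequence of α(Y) containing c is the a-run of a single block.  A reflection
-- centres c in b α(l) with l ∈ {a, b, aa}.  For l = aa the centre of
-- b a^p b a^p b is its middle b, so l is a letter and c is centred in the a-run
-- of α(l), i.e. in its a-sequence.  Conversely, if c is centred in its
-- a-sequence, desubstituting α(Y) at the b just before that a-sequence exhibits
-- the surrounding block as α(l) for a letter l.
module Submission where

open import Defs
open import Data.Nat using (ℕ; zero; suc; _+_; _≤_; s≤s; z≤n)
open import Data.Nat.Properties
  using (+-comm; suc-injective; m≤m+n; m≤n+m; ≤-trans; ≤-reflexive; <⇒≢; +-mono-≤)
open import Data.List using (List; []; _∷_; _++_; length; reverse; replicate)
open import Data.List.Properties
  using (++-assoc; ++-identityʳ; ++-cancelˡ; reverse-++; length-++; length-replicate; ∷-injective; ∷-injectiveʳ)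
open import Data.Sum using (_⊎_; inj₁; inj₂)
open import Data.Product using (∃-syntax; _×_; _,_; proj₁; proj₂)
open import Data.Empty using (⊥-elim)
open import Function.Bundles using (_⇔_; mk⇔)
open import Function.Related.TypeIsomorphisms using (¬-cong-⇔)
open import Relation.Nullary using (¬_)
open import Relation.Binary.PropositionalEquality using (_≡_; _≢_; refl; sym; trans; cong; subst; module ≡-Reasoning)

module _ {A : Set} where

  ++-split-length : ∀ (xs ys : List A) {zs ws : List A} → length xs ≡ length ys →
                    xs ++ zs ≡ ys ++ ws → xs ≡ ys × zs ≡ ws
  ++-split-length []       []       _   eq = refl , eq
  ++-split-length (x ∷ xs) (y ∷ ys) len eq with ∷-injective eq
  ... | refl , eq′ with ++-split-length xs ys (suc-injective len) eq′
  ...   | refl , zs≡ws = refl , zs≡ws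

  replicate-+-++ : ∀ m n (x : A) (w : List A) →
                   replicate (m + n) x ++ w ≡ replicate m x ++ replicate n x ++ w
  replicate-+-++ zero    n x w = refl
  replicate-+-++ (suc m) n x w = cong (x ∷_) (replicate-+-++ m n x w)

  length-replicate-++ : ∀ n (x : A) (w : List A) → length (replicate n x ++ w) ≡ n + length w
  length-replicate-++ n x w = trans (length-++ (replicate n x)) (cong (_+ length w) (length-replicate n))

  ++-reassociate-centre : ∀ (z₁ u c v z₂ : List A) {X} → X ≡ z₁ ++ (u ++ c ++ v) ++ z₂ →
                          X ≡ (z₁ ++ u) ++ c ++ v ++ z₂
  ++-reassociate-centre z₁ u c v z₂ {X} X≡ = begin
    X                            ≡⟨ X≡ ⟩
    z₁ ++ (u ++ c ++ v) ++ z₂    ≡⟨ cong (z₁ ++_) (++-assoc u (c ++ v) z₂) ⟩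
    z₁ ++ u ++ (c ++ v) ++ z₂    ≡⟨ cong (λ w → z₁ ++ u ++ w) (++-assoc c v z₂) ⟩
    z₁ ++ u ++ c ++ v ++ z₂      ≡⟨ ++-assoc z₁ u (c ++ v ++ z₂) ⟨
    (z₁ ++ u) ++ c ++ v ++ z₂    ∎
    where open ≡-Reasoning

  length-∷ʳ : ∀ (xs : List A) x → length (xs ++ x ∷ []) ≡ suc (length xs)
  length-∷ʳ []       x = refl
  length-∷ʳ (_ ∷ xs) x = cong suc (length-∷ʳ xs x)

  replicate-∷ʳ : ∀ n (x : A) → replicate n x ++ x ∷ [] ≡ x ∷ replicate n x
  replicate-∷ʳ zero    x = refl
  replicate-∷ʳ (suc n) x = cong (x ∷_) (replicate-∷ʳ n x)

  reverse-replicate : ∀ n (x : A) → reverse (replicate n x) ≡ replicate n x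
  reverse-replicate zero    x = refl
  reverse-replicate (suc n) x = begin
    reverse (x ∷ replicate n x)            ≡⟨ reverse-++ (x ∷ []) (replicate n x) ⟩
    reverse (replicate n x) ++ x ∷ []      ≡⟨ cong (_++ x ∷ []) (reverse-replicate n x) ⟩
    replicate n x ++ x ∷ []                ≡⟨ replicate-∷ʳ n x ⟩
    x ∷ replicate n x                      ∎
    where open ≡-Reasoning

data NoLeadingA : Word → Set where
  empty   : NoLeadingA []
  startsB : ∀ w → NoLeadingA (b ∷ w)

NoTrailingA : Word → Set
NoTrailingA w = w ≡ [] ⊎ ∃[ w′ ] w ≡ w′ ++ b ∷ []

noTrailingA-∷ʳb : ∀ w → NoTrailingA (w ++ b ∷ [])
noTrailingA-∷ʳb w = inj₂ (w , refl)

noTrailingA-++ : ∀ {v w} → NoTrailingA v → NoTrailingA w → NoTrailingA (v ++ w)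
noTrailingA-++ {v} nv (inj₁ refl)          = subst NoTrailingA (sym (++-identityʳ v)) nv
noTrailingA-++ {v} _  (inj₂ (w′ , refl)) = inj₂ (v ++ w′ , sym (++-assoc v w′ (b ∷ [])))

noTrailingA⇒reverse-noLeadingA : ∀ {w} → NoTrailingA w → NoLeadingA (reverse w)
noTrailingA⇒reverse-noLeadingA (inj₁ refl)          = empty
noTrailingA⇒reverse-noLeadingA (inj₂ (w′ , refl)) =
  subst NoLeadingA (sym (reverse-++ w′ (b ∷ []))) (startsB (reverse w′))

leading-a-run-unique : ∀ m n {v w} → NoLeadingA v → NoLeadingA w →
                       replicate m a ++ v ≡ replicate n a ++ w → m ≡ n
leading-a-run-unique zero    zero    _ _ _ = refl
leading-a-run-unique (suc m) (suc n) nv nw eq = cong suc (leading-a-run-unique m n nv nw (∷-injectiveʳ eq))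
leading-a-run-unique zero    (suc n) empty       _ ()
leading-a-run-unique zero    (suc n) (startsB _) _ ()
leading-a-run-unique (suc m) zero    _ empty       ()
leading-a-run-unique (suc m) zero    _ (startsB _) ()

trailing-a-run-unique : ∀ m n {v w} → NoTrailingA v → NoTrailingA w →
                        v ++ replicate m a ≡ w ++ replicate n a → m ≡ n
trailing-a-run-unique m n {v} {w} nv nw eq =
  leading-a-run-unique m n (noTrailingA⇒reverse-noLeadingA nv) (noTrailingA⇒reverse-noLeadingA nw) (begin
    replicate m a ++ reverse v              ≡⟨ cong (_++ reverse v) (reverse-replicate m a) ⟨
    reverse (replicate m a) ++ reverse v    ≡⟨ reverse-++ v (replicate m a) ⟨
    reverse (v ++ replicate m a)            ≡⟨ cong reverse eq ⟩
    reverse (w ++ replicate n a)            ≡⟨ reverse-++ w (replicate n a) ⟩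
    reverse (replicate n a) ++ reverse w    ≡⟨ cong (_++ reverse w) (reverse-replicate n a) ⟩
    replicate n a ++ reverse w              ∎)
  where open ≡-Reasoning

a-block-split-at-b : ∀ k w u r → replicate k a ++ b ∷ w ≡ u ++ b ∷ r →
  (u ≡ replicate k a × w ≡ r) ⊎ (∃[ u′ ] u ≡ replicate k a ++ b ∷ u′ × w ≡ u′ ++ b ∷ r)
a-block-split-at-b zero    w []      r eq = inj₁ (refl , ∷-injectiveʳ eq)
a-block-split-at-b zero    w (_ ∷ u) r eq with ∷-injective eq
... | refl , eq′ = inj₂ (u , refl , eq′)
a-block-split-at-b (suc k) w (_ ∷ u) r eq with ∷-injective eq
... | refl , eq′ with a-block-split-at-b k w u r eq′
...   | inj₁ (u≡ , w≡r)      = inj₁ (cong (a ∷_) u≡ , w≡r)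
...   | inj₂ (u′ , u≡ , w≡)    = inj₂ (u′ , cong (a ∷_) u≡ , w≡)

a-block-drop-a-run : ∀ k n w v → replicate k a ++ b ∷ w ≡ replicate n a ++ v →
                     ∃[ e ] v ≡ replicate e a ++ b ∷ w × n + e ≡ k
a-block-drop-a-run k       zero    w v eq = k , sym eq , refl
a-block-drop-a-run (suc k) (suc n) w v eq with a-block-drop-a-run k n w v (∷-injectiveʳ eq)
... | e , v≡ , n+e≡k = e , v≡ , cong suc n+e≡k

a-run-in-a-block : ∀ k j w u v → replicate k a ++ b ∷ w ≡ u ++ replicate (suc j) a ++ v →
  (∃[ d ] ∃[ e ] u ≡ replicate d a × v ≡ replicate e a ++ b ∷ w × d + suc j + e ≡ k)
  ⊎ (∃[ u′ ] u ≡ replicate k a ++ b ∷ u′ × w ≡ u′ ++ replicate (suc j) a ++ v)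
a-run-in-a-block k j w [] v eq with a-block-drop-a-run k (suc j) w v eq
... | e , v≡ , sum = inj₁ (0 , e , refl , v≡ , sum)
a-run-in-a-block zero    j w (_ ∷ u) v eq with ∷-injective eq
... | refl , eq′ = inj₂ (u , refl , eq′)
a-run-in-a-block (suc k) j w (_ ∷ u) v eq with ∷-injective eq
... | refl , eq′ with a-run-in-a-block k j w u v eq′
...   | inj₁ (d , e , u≡ , v≡ , sum) = inj₁ (suc d , e , cong (a ∷_) u≡ , v≡ , cong suc sum)
...   | inj₂ (u′ , u≡ , w≡)         = inj₂ (u′ , cong (a ∷_) u≡ , w≡)

a-block-injective : ∀ m n {v w} → replicate m a ++ b ∷ v ≡ replicate n a ++ b ∷ w → m ≡ n × v ≡ w
a-block-injective zero    zero    eq = refl , ∷-injectiveʳ eq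
a-block-injective (suc m) (suc n) eq with a-block-injective m n (∷-injectiveʳ eq)
... | refl , v≡w = refl , v≡w

Pivot : Word → Set
Pivot l = l ≡ a ∷ [] ⊎ l ≡ b ∷ [] ⊎ l ≡ a ∷ a ∷ []

run-summands-≤ : ∀ d j e {k} → d + suc j + e ≡ k → d ≤ k × e ≤ k
run-summands-≤ d j e refl = ≤-trans (m≤m+n d (suc j)) (m≤m+n (d + suc j) e) , m≤n+m e (d + suc j)

balanced-runs : ∀ d e → suc (length (replicate d a)) ≡ length (replicate e a ++ b ∷ []) → d ≡ e
balanced-runs d e eq = begin
  d                         ≡⟨ length-replicate d ⟨
  length (replicate d a)    ≡⟨ suc-injective (trans eq (length-∷ʳ (replicate e a) b)) ⟩
  length (replicate e a)    ≡⟨ length-replicate e ⟩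
  e                         ∎
  where open ≡-Reasoning

first-block-too-short : ∀ {d e p} → d ≤ p → suc d ≢ e + suc (p + 1)
first-block-too-short {e = e} {p} d≤p =
  <⇒≢ (≤-trans (s≤s (≤-trans (s≤s d≤p) (≤-reflexive (+-comm 1 p)))) (m≤n+m (suc (p + 1)) e))

second-block-too-long : ∀ {d e p} → e ≤ p → suc (p + suc d) ≢ e + 1
second-block-too-long e≤p eq = <⇒≢ (s≤s (+-mono-≤ e≤p (s≤s z≤n))) (sym eq)

letter-pivot : ∀ x → Pivot (x ∷ [])
letter-pivot a = inj₁ refl
letter-pivot b = inj₂ (inj₁ refl)

a-run-split : ∀ d n e w → replicate (d + n + e) a ++ w ≡ replicate d a ++ replicate n a ++ replicate e a ++ w
a-run-split d n e w = trans (replicate-+-++ (d + n) e a w) (replicate-+-++ d n a (replicate e a ++ w))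

αexp : ℕ → ℕ → Letter → ℕ
αexp p p' a = p
αexp p p' b = p'

module _ (p p' : ℕ) where

  α-∷ : ∀ x t → α p p' (x ∷ t) ≡ replicate (αexp p p' x) a ++ b ∷ α p p' t
  α-∷ a t = ++-assoc (replicate p a) (b ∷ []) (α p p' t)
  α-∷ b t = ++-assoc (replicate p' a) (b ∷ []) (α p p' t)

  α-[_] : ∀ x → α p p' (x ∷ []) ≡ replicate (αexp p p' x) a ++ b ∷ []
  α-[ x ] = α-∷ x []

  α-noTrailingA : ∀ t → NoTrailingA (α p p' t)
  α-noTrailingA []      = inj₁ refl
  α-noTrailingA (x ∷ t) =
    subst NoTrailingA (sym (trans (α-∷ x t) (sym (++-assoc (replicate (αexp p p' x) a) (b ∷ []) (α p p' t)))))
      (noTrailingA-++ (noTrailingA-∷ʳb (replicate (αexp p p' x) a)) (α-noTrailingA t))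

  α-desubstitute-at-b : ∀ Y u r → α p p' Y ≡ u ++ b ∷ r →
    ∃[ t ] ∃[ Y′ ] Y ≡ t ++ Y′ × α p p' t ≡ u ++ b ∷ [] × α p p' Y′ ≡ r
  α-desubstitute-at-b []      []      r ()
  α-desubstitute-at-b []      (_ ∷ _) r ()
  α-desubstitute-at-b (x ∷ Y) u r eq
    with a-block-split-at-b (αexp p p' x) (α p p' Y) u r (trans (sym (α-∷ x Y)) eq)
  ... | inj₁ (refl , αY≡r) = x ∷ [] , Y , refl , α-[ x ] , αY≡r
  ... | inj₂ (u′ , refl , αY≡) with α-desubstitute-at-b Y u′ r αY≡
  ...   | t , Y′ , refl , αt≡ , αY′≡r = x ∷ t , Y′ , refl , αxt≡ , αY′≡r
    where
    open ≡-Reasoning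
    αxt≡ : α p p' (x ∷ t) ≡ (replicate (αexp p p' x) a ++ b ∷ u′) ++ b ∷ []
    αxt≡ = begin
      α p p' (x ∷ t)                                   ≡⟨ α-∷ x t ⟩
      replicate (αexp p p' x) a ++ b ∷ α p p' t        ≡⟨ cong (λ w → replicate (αexp p p' x) a ++ b ∷ w) αt≡ ⟩
      replicate (αexp p p' x) a ++ b ∷ u′ ++ b ∷ []    ≡⟨ ++-assoc (replicate (αexp p p' x) a) (b ∷ u′) (b ∷ []) ⟨
      (replicate (αexp p p' x) a ++ b ∷ u′) ++ b ∷ []  ∎

  α-desubstitute-block : ∀ Y k w → α p p' Y ≡ replicate k a ++ b ∷ w →
    ∃[ x ] ∃[ t ] Y ≡ x ∷ t × αexp p p' x ≡ k × α p p' t ≡ w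
  α-desubstitute-block [] zero    w ()
  α-desubstitute-block [] (suc k) w ()
  α-desubstitute-block (x ∷ t) k w eq = x , t , refl , a-block-injective (αexp p p' x) k (trans (sym (α-∷ x t)) eq)


  centred-in-letter-image : ∀ x j u v → α p p' (x ∷ []) ≡ u ++ replicate (suc j) a ++ v →
    suc (length u) ≡ length v → ∃[ k ] u ≡ replicate k a × v ≡ replicate k a ++ b ∷ []
  centred-in-letter-image x j u v eq len with a-run-in-a-block (αexp p p' x) j [] u v (trans (sym (α-[ x ])) eq)
  ... | inj₁ (d , e , refl , refl , _) with balanced-runs d e len
  ...   | refl = d , refl , refl
  centred-in-letter-image x j u v eq len | inj₂ ([] , _ , ())
  centred-in-letter-image x j u v eq len | inj₂ (_ ∷ _ , _ , ())

  not-centred-in-α-aa : ∀ j u v → α p p' (a ∷ a ∷ []) ≡ u ++ replicate (suc j) a ++ v →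
    suc (length u) ≢ length v
  not-centred-in-α-aa j u v eq len with a-run-in-a-block p j (α p p' (a ∷ [])) u v (trans (sym (α-∷ a (a ∷ []))) eq)
  ... | inj₁ (d , e , refl , refl , sum) = first-block-too-short (proj₁ (run-summands-≤ d j e sum)) (begin
    suc d                                           ≡⟨ cong suc (length-replicate d) ⟨
    suc (length (replicate d a))                    ≡⟨ len ⟩
    length (replicate e a ++ b ∷ α p p' (a ∷ []))   ≡⟨ length-replicate-++ e a _ ⟩
    e + suc (length (α p p' (a ∷ [])))              ≡⟨ cong (λ n → e + suc n) |α[a]| ⟩
    e + suc (p + 1)                                 ∎)
    where
    open ≡-Reasoning
    |α[a]| : length (α p p' (a ∷ [])) ≡ p + 1
    |α[a]| = trans (cong length (α-[ a ])) (length-replicate-++ p a (b ∷ []))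
  ... | inj₂ (u′ , refl , eq′) with a-run-in-a-block p j [] u′ v (trans (sym (α-[ a ])) eq′)
  ...   | inj₁ (d , e , refl , refl , sum) = second-block-too-long (proj₂ (run-summands-≤ d j e sum)) (begin
    suc (p + suc d)                                     ≡⟨ cong (λ n → suc (p + suc n)) (length-replicate d) ⟨
    suc (p + length (b ∷ replicate d a))                ≡⟨ cong suc (length-replicate-++ p a _) ⟨
    suc (length (replicate p a ++ b ∷ replicate d a))   ≡⟨ len ⟩
    length (replicate e a ++ b ∷ [])                    ≡⟨ length-replicate-++ e a _ ⟩
    e + 1                                               ∎)
    where open ≡-Reasoning
  ...   | inj₂ ([] , _ , ())
  ...   | inj₂ (_ ∷ _ , _ , ())

  centred-in-pivot-image : ∀ l j u v → Pivot l → α p p' l ≡ u ++ replicate (suc j) a ++ v →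
    suc (length u) ≡ length v → ∃[ k ] u ≡ replicate k a × v ≡ replicate k a ++ b ∷ []
  centred-in-pivot-image _ j u v (inj₁ refl)        = centred-in-letter-image a j u v
  centred-in-pivot-image _ j u v (inj₂ (inj₁ refl)) = centred-in-letter-image b j u v
  centred-in-pivot-image _ j u v (inj₂ (inj₂ refl)) eq len = ⊥-elim (not-centred-in-α-aa j u v eq len)


  reflection⇒balanced : ∀ Y U′ V′ j d e →
    Reflection p p' Y ((U′ ++ b ∷ []) ++ replicate d a) (replicate (suc j) a) (replicate e a ++ b ∷ V′) → d ≡ e
  reflection⇒balanced Y U′ V′ j d e (t₁ , l , t₂ , u , v , _ , pivot , αl≡ , x₁≡ , x₂≡ , len)
    with centred-in-pivot-image l j u v pivot αl≡ len
  ... | k , refl , refl = trans d≡k (sym e≡k)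
    where
    d≡k : d ≡ k
    d≡k = trailing-a-run-unique d k (noTrailingA-∷ʳb U′) (α-noTrailingA t₁) x₁≡
    e≡k : e ≡ k
    e≡k = leading-a-run-unique e k (startsB V′) (startsB (α p p' t₂))
            (trans x₂≡ (++-assoc (replicate k a) (b ∷ []) (α p p' t₂)))

  balanced⇒reflection : ∀ Y U′ V′ j d →
    α p p' Y ≡ ((U′ ++ b ∷ []) ++ replicate d a) ++ replicate (suc j) a ++ replicate d a ++ b ∷ V′ →
    Reflection p p' Y ((U′ ++ b ∷ []) ++ replicate d a) (replicate (suc j) a) (replicate d a ++ b ∷ V′)
  balanced⇒reflection Y U′ V′ j d αY≡
    with α-desubstitute-at-b Y U′ (replicate d a ++ replicate (suc j) a ++ replicate d a ++ b ∷ V′) αY≡U′b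
    where
    αY≡U′b : α p p' Y ≡ U′ ++ b ∷ replicate d a ++ replicate (suc j) a ++ replicate d a ++ b ∷ V′
    αY≡U′b = trans αY≡ (trans (++-assoc (U′ ++ b ∷ []) (replicate d a) _) (++-assoc U′ (b ∷ []) _))
  ... | t₁ , Y′ , refl , αt₁≡ , αY′≡
    with α-desubstitute-block Y′ (d + suc j + d) V′ (trans αY′≡ (sym (a-run-split d (suc j) d (b ∷ V′))))
  ... | x , t₂ , refl , exp≡ , αt₂≡ =
    t₁ , x ∷ [] , t₂ , replicate d a , replicate d a ++ b ∷ [] ,
    refl , letter-pivot x , αx≡ , cong (_++ replicate d a) (sym αt₁≡) , x₂≡ , sym (length-∷ʳ (replicate d a) b)
    where
    open ≡-Reasoning
    αx≡ : α p p' (x ∷ []) ≡ replicate d a ++ replicate (suc j) a ++ replicate d a ++ b ∷ []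
    αx≡ = begin
      α p p' (x ∷ [])                        ≡⟨ α-[ x ] ⟩
      replicate (αexp p p' x) a ++ b ∷ []    ≡⟨ cong (λ n → replicate n a ++ b ∷ []) exp≡ ⟩
      replicate (d + suc j + d) a ++ b ∷ []  ≡⟨ a-run-split d (suc j) d (b ∷ []) ⟩
      replicate d a ++ replicate (suc j) a ++ replicate d a ++ b ∷ [] ∎
    x₂≡ : replicate d a ++ b ∷ V′ ≡ (replicate d a ++ b ∷ []) ++ α p p' t₂
    x₂≡ = begin
      replicate d a ++ b ∷ V′                ≡⟨ cong (λ w → replicate d a ++ b ∷ w) αt₂≡ ⟨
      replicate d a ++ b ∷ α p p' t₂         ≡⟨ ++-assoc (replicate d a) (b ∷ []) (α p p' t₂) ⟨
      (replicate d a ++ b ∷ []) ++ α p p' t₂ ∎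

  reflection⇔balanced : ∀ Y {x₁ x₂} U′ V′ j d e →
    α p p' Y ≡ ((U′ ++ b ∷ []) ++ replicate d a) ++ replicate (suc j) a ++ replicate e a ++ b ∷ V′ →
    x₁ ≡ (U′ ++ b ∷ []) ++ replicate d a → x₂ ≡ replicate e a ++ b ∷ V′ →
    Reflection p p' Y x₁ (replicate (suc j) a) x₂ ⇔ d ≡ e
  reflection⇔balanced Y U′ V′ j d e αY≡ refl refl =
    mk⇔ (reflection⇒balanced Y U′ V′ j d e) (λ { refl → balanced⇒reflection Y U′ V′ j d αY≡ })

centre-splits-a-sequence : ∀ {X x₁ x₂ U V} n m d e → X ≡ x₁ ++ replicate n a ++ x₂ →
  X ≡ U ++ replicate m a ++ V → length x₁ ≡ length U + d → d + length (replicate n a) + e ≡ m →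
  X ≡ (U ++ replicate d a) ++ replicate n a ++ replicate e a ++ V
  × x₁ ≡ U ++ replicate d a × x₂ ≡ replicate e a ++ V
centre-splits-a-sequence {X} {x₁} {x₂} {U} {V} n m d e X≡x₁cx₂ X≡UaV |x₁| refl =
  X≡UacaV , proj₁ split , ++-cancelˡ (replicate n a) x₂ (replicate e a ++ V) (proj₂ split)
  where
  X≡UacaV : X ≡ (U ++ replicate d a) ++ replicate n a ++ replicate e a ++ V
  X≡UacaV = trans X≡UaV (trans (cong (U ++_) (trans (cong (λ k → replicate (d + k + e) a ++ V) (length-replicate n))
                                                     (a-run-split d n e V)))
                               (sym (++-assoc U (replicate d a) _)))
  split : x₁ ≡ U ++ replicate d a × replicate n a ++ x₂ ≡ replicate n a ++ replicate e a ++ V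
  split = ++-split-length x₁ (U ++ replicate d a)
            (trans |x₁| (sym (trans (length-++ U) (cong (length U +_) (length-replicate d)))))
            (trans (sym X≡x₁cx₂) X≡UacaV)

centre-a-run : ∀ {c} → c ≡ a ∷ [] ⊎ c ≡ a ∷ a ∷ [] → ∃[ j ] c ≡ replicate (suc j) a
centre-a-run (inj₁ refl) = 0 , refl
centre-a-run (inj₂ refl) = 1 , refl

corollary1 : (p p' : ℕ) → 1 ≤ p → 1 ≤ p' → DiffOne p p' →
    (Y : Word) → Sturmian (α p p' Y) →
    (z₁ x z₂ u c v : Word) →
    α p p' Y ≡ z₁ ++ x ++ z₂ →
    reverse x ≡ x →
    x ≡ u ++ c ++ v → length u ≡ length v →
    (c ≡ a ∷ [] ⊎ c ≡ a ∷ a ∷ []) →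
    (U V : Word) (m d e : ℕ) →
    ASequence (α p p' Y) U m V →
    length (z₁ ++ u) ≡ length U + d →
    d + length c + e ≡ m →
    Original p p' Y (z₁ ++ u) c (v ++ z₂) ⇔ (¬ (d ≡ e))
corollary1 p p' _ _ _ Y _ z₁ _ z₂ u c v αY≡ _ refl _ c-centre _ _ m d e (αY≡UaV , (U′ , refl) , (V′ , refl)) |x₁| sum
  with centre-a-run c-centre
... | j , refl
  with centre-splits-a-sequence (suc j) m d e (++-reassociate-centre z₁ u (replicate (suc j) a) v z₂ αY≡) αY≡UaV |x₁| sum
...   | αY≡UacaV , x₁≡ , x₂≡ = ¬-cong-⇔ (reflection⇔balanced p p' Y U′ V′ j d e αY≡UacaV x₁≡ x₂≡)
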